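{- Let $\mathcal{A}$ be a deterministic parity automaton over $\{0,1\}^3$. (1) There is a monadic second-order formula $\psi_I(X,Y,U)$ over $\tau_{\mathcal{A}}$ such that for every $\mathbf{P}\subseteq\mathbb{N}$: $M_{\mathcal{A},\mathbf{P}}\models\psi_I(\mathbf{X},\mathbf{Y},\mathbf{U})$ iff $\mathbf{U}\subseteq V_1$ (a memoryless strategy of Player I), $\mathbf{X},\mathbf{Y}\subseteq R_{q_{init}}$, and $\mathbf{X}=F_{\mathbf{U}}(\mathbf{Y})$. (2) There is a monadic second-order formula $\psi_{II}(X,Y,U)$ such that $M_{\mathcal{A},\mathbf{P}}\models\psi_{II}(\mathbf{X},\mathbf{Y},\mathbf{U})$ iff $\mathbf{U}\subseteq V_2$ (a memoryless strategy of Player II), $\mathbf{X},\mathbf{Y}\subseteq R_{q_{init}}$, and $\mathbf{Y}=F_{\mathbf{U}}(\mathbf{X})$. (3) Moreover, $\psi_I$ and $\psi_{II}$ are computable from $\mathcal{A}$.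
   Context: A deterministic parity automaton $\mathcal{A}=\langle Q,\Sigma,\delta,q_{init},col\rangle$ has finite state set $Q$, $\delta:Q\times\Sigma\to Q$, $q_{init}\in Q$, $col:Q\to\mathbb{N}$. Game graph $G_{\mathcal{A},\mathbf{P}}$ ($\mathbf{P}\subseteq\mathbb{N}$): $V_1=Q\times\mathbb{N}$, $V_2=Q\times\{0,1\}\times\mathbb{N}$. From $\langle q,n\rangle$ there is an edge labelled $0$ to $\langle q,0,n\rangle$ and one labelled $1$ to $\langle q,1,n\rangle$. From $\langle q,a,n\rangle$, with $c=1$ if $n\in\mathbf{P}$ and $c=0$ otherwise, an edge labelled $b$ leads to $\langle\delta(q,\langle a,b,c\rangle),n+1\rangle$ ($b\in\{0,1\}$). Plays start at $\langle q_{init},0\rangle$; Player I chooses at $V_1$ nodes, Player II at $V_2$ nodes. For $U\subseteq V_1$ (resp. $V_2$) the memoryless strategy $f_U$ takes, at each node $v$ of its owner, the edge labelled $1$ iff $v\in U$. Induced operators on $\{0,1\}^\omega$: for $U\subseteq V_1$ and $b_0b_1\dots$, consider the unique play where Player I follows $f_U$ and the edges leaving successive $V_2$ nodes are labelled $b_0,b_1,\dots$; with successive $V_1$ nodes $v_0,v_1,\dots$, $F_U(b_0b_1\dots)=a_0a_1\dots$ where $a_i=1$ iff $v_i\in U$. For $U\subseteq V_2$ and $a_0a_1\dots$, consider the unique play where the edges leaving successive $V_1$ nodes are labelled $a_0,a_1,\dots$ and Player II follows $f_U$; with successive $V_2$ nodes $w_0,w_1,\dots$, $F_U(a_0a_1\dots)=b_0b_1\dots$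 with $b_i=1$ iff $w_i\in U$. The structure $M_{\mathcal{A},\mathbf{P}}$ has universe $V_1\cup V_2$ and signature $\tau_{\mathcal{A}}=\{R_i:i\in Q\cup Q\times\{0,1\}\}\cup\{\mathit{Init},P,\prec,E_0,E_1\}$: $R_q=\{\langle q,j\rangle:j\in\mathbb{N}\}$, $R_{\langle q,a\rangle}=\{\langle q,a,j\rangle:j\in\mathbb{N}\}$, $P=\{\langle q,m\rangle,\langle q,a,m\rangle:m\in\mathbf{P}\}$, $\mathit{Init}=\{\langle q_{init},0\rangle\}$, $E_b$ = edges labelled $b$, $v_1\prec v_2$ iff the last ($\mathbb{N}$-) coordinate of $v_1$ is smaller than that of $v_2$. An $\omega$-string $s_0s_1\dots\in\{0,1\}^\omega$ is represented by the subset $\{\langle q_{init},j\rangle: s_j=1\}$ of $R_{q_{init}}$, and operators on $\{0,1\}^\omega$ are identified with the corresponding maps on subsets of $R_{q_{init}}$. -}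

module Defs where

open import Data.Nat using (ℕ; zero; suc; _<_)
open import Data.Fin using (Fin; _≟_)
open import Data.Bool using (Bool; true; false; _∧_; if_then_else_)
open import Data.Product using (_×_; _,_; Σ; ∃)
open import Data.Sum using (_⊎_; inj₁; inj₂)
open import Data.Empty using (⊥)
open import Data.Unit using (⊤)
open import Relation.Nullary using (¬_; does)
open import Relation.Binary.PropositionalEquality using (_≡_)

Letter : Set
Letter = Bool × Bool × Bool

record Automaton : Set where
  field
    nQ    : ℕ
    δ     : Fin nQ → Letter → Fin nQ
    qinit : Fin nQ
    col   : Fin nQ → ℕ
open Automaton public

V₁ : ℕ → Set
V₁ n = Fin n × ℕ

V₂ : ℕ → Set
V₂ n = Fin n × Bool × ℕ

V : ℕ → Set
V n = V₁ n ⊎ V₂ n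

level : ∀ {n} → V n → ℕ
level (inj₁ (_ , i)) = i
level (inj₂ (_ , _ , i)) = i

SubsetN : Set
SubsetN = ℕ → Bool

Subset : ℕ → Set
Subset n = V n → Bool

Edge : (A : Automaton) → SubsetN → Bool → V (nQ A) → V (nQ A) → Set
Edge A P b (inj₁ (q , i)) (inj₂ (q' , a , j)) = (q ≡ q') × (a ≡ b) × (i ≡ j)
Edge A P b (inj₂ (q , a , i)) (inj₁ (q' , j)) = (δ A q (a , b , P i) ≡ q') × (j ≡ suc i)
Edge A P b (inj₁ _) (inj₁ _) = ⊥
Edge A P b (inj₂ _) (inj₂ _) = ⊥

-- Monadic second-order formulas over τ_A (n = number of states),
-- well-scoped: k first-order variables and m set variables in scope.

data Formula (n : ℕ) : ℕ → ℕ → Set where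
  R₁    : ∀ {k m} → Fin n → Fin k → Formula n k m
  R₂    : ∀ {k m} → Fin n → Bool → Fin k → Formula n k m
  Init  : ∀ {k m} → Fin k → Formula n k m
  Pp    : ∀ {k m} → Fin k → Formula n k m
  Prec  : ∀ {k m} → Fin k → Fin k → Formula n k m
  E     : ∀ {k m} → Bool → Fin k → Fin k → Formula n k m
  Eq    : ∀ {k m} → Fin k → Fin k → Formula n k m
  Mem   : ∀ {k m} → Fin k → Fin m → Formula n k m
  Not   : ∀ {k m} → Formula n k m → Formula n k m
  And   : ∀ {k m} → Formula n k m → Formula n k m → Formula n k m
  Or    : ∀ {k m} → Formula n k m → Formula n k m → Formula n k m
  Imp   : ∀ {k m} → Formula n k m → Formula n k m → Formula n k m
  Ex₁   : ∀ {k m} → Formula n (suc k) m → Formula n k m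
  All₁  : ∀ {k m} → Formula n (suc k) m → Formula n k m
  Ex₂   : ∀ {k m} → Formula n k (suc m) → Formula n k m
  All₂  : ∀ {k m} → Formula n k (suc m) → Formula n k m

extend : ∀ {k} {B : Set} → B → (Fin k → B) → Fin (suc k) → B
extend b ρ Fin.zero = b
extend b ρ (Fin.suc i) = ρ i

InR₁ : ∀ {n} → Fin n → V n → Set
InR₁ q (inj₁ (q' , _)) = q' ≡ q
InR₁ q (inj₂ _) = ⊥

InR₂ : ∀ {n} → Fin n → Bool → V n → Set
InR₂ q a (inj₁ _) = ⊥
InR₂ q a (inj₂ (q' , a' , _)) = (q' ≡ q) × (a' ≡ a)

Sat : (A : Automaton) (P : SubsetN) {k m : ℕ} → Formula (nQ A) k m →
      (Fin k → V (nQ A)) → (Fin m → Subset (nQ A)) → Set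
Sat A P (R₁ q x) ρ σ = InR₁ q (ρ x)
Sat A P (R₂ q a x) ρ σ = InR₂ q a (ρ x)
Sat A P (Init x) ρ σ = ρ x ≡ inj₁ (qinit A , zero)
Sat A P (Pp x) ρ σ = P (level (ρ x)) ≡ true
Sat A P (Prec x y) ρ σ = level (ρ x) < level (ρ y)
Sat A P (E b x y) ρ σ = Edge A P b (ρ x) (ρ y)
Sat A P (Eq x y) ρ σ = ρ x ≡ ρ y
Sat A P (Mem x X) ρ σ = σ X (ρ x) ≡ true
Sat A P (Not φ) ρ σ = ¬ Sat A P φ ρ σ
Sat A P (And φ ψ) ρ σ = Sat A P φ ρ σ × Sat A P ψ ρ σ
Sat A P (Or φ ψ) ρ σ = Sat A P φ ρ σ ⊎ Sat A P ψ ρ σ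
Sat A P (Imp φ ψ) ρ σ = Sat A P φ ρ σ → Sat A P ψ ρ σ
Sat A P (Ex₁ φ) ρ σ = Σ (V (nQ A)) λ v → Sat A P φ (extend v ρ) σ
Sat A P (All₁ φ) ρ σ = (v : V (nQ A)) → Sat A P φ (extend v ρ) σ
Sat A P (Ex₂ φ) ρ σ = Σ (Subset (nQ A)) λ S → Sat A P φ ρ (extend S σ)
Sat A P (All₂ φ) ρ σ = (S : Subset (nQ A)) → Sat A P φ ρ (extend S σ)

noVars : ∀ {n} → Fin 0 → V n
noVars ()

assign3 : ∀ {n} → Subset n → Subset n → Subset n → Fin 3 → Subset n
assign3 X Y U Fin.zero = X
assign3 X Y U (Fin.suc Fin.zero) = Y
assign3 X Y U (Fin.suc (Fin.suc Fin.zero)) = U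

Models : (A : Automaton) (P : SubsetN) → Formula (nQ A) 0 3 →
         Subset (nQ A) → Subset (nQ A) → Subset (nQ A) → Set
Models A P ψ X Y U = Sat A P ψ noVars (assign3 X Y U)

_⊆V₁ : ∀ {n} → Subset n → Set
U ⊆V₁ = ∀ v → U v ≡ true → Σ _ λ w → v ≡ inj₁ w

_⊆V₂ : ∀ {n} → Subset n → Set
U ⊆V₂ = ∀ v → U v ≡ true → Σ _ λ w → v ≡ inj₂ w

InitRow : (A : Automaton) → Subset (nQ A) → Set
InitRow A X = ∀ v → X v ≡ true → InR₁ (qinit A) v

Str : Set
Str = ℕ → Bool

rep : (A : Automaton) → Str → Subset (nQ A)
rep A s (inj₁ (q , j)) = does (q ≟ qinit A) ∧ s j
rep A s (inj₂ _) = false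

unrep : (A : Automaton) → Subset (nQ A) → Str
unrep A X j = X (inj₁ (qinit A , j))

-- Player I follows f_U, Player II plays b₀b₁…; state at the i-th V₁ node
stateI : (A : Automaton) → SubsetN → Subset (nQ A) → Str → ℕ → Fin (nQ A)
stateI A P U b zero = qinit A
stateI A P U b (suc i) =
  let q = stateI A P U b i in δ A q (U (inj₁ (q , i)) , b i , P i)

FI : (A : Automaton) → SubsetN → Subset (nQ A) → Str → Str
FI A P U b i = U (inj₁ (stateI A P U b i , i))

-- Player I plays a₀a₁…, Player II follows f_U
stateII : (A : Automaton) → SubsetN → Subset (nQ A) → Str → ℕ → Fin (nQ A)
stateII A P U a zero = qinit A
stateII A P U a (suc i) =
  let q = stateII A P U a i in δ A q (a i , U (inj₂ (q , a i , i)) , P i)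

FII : (A : Automaton) → SubsetN → Subset (nQ A) → Str → Str
FII A P U a i = U (inj₂ (stateII A P U a i , a i , i))

_≐_ : ∀ {n} → Subset n → Subset n → Set
X ≐ Y = ∀ v → X v ≡ Y v

module Submission where

-- MSO cannot define the play of the game by recursion on the level, so
-- both formulas guess a set Z of V₁ nodes containing ⟨q_init, 0⟩ and closed
-- under one round of the game, whose two edge labels are read off the
-- strategy U and off the row of R_{q_init} at the current level.  Every such
-- Z contains the V₁ nodes of the play, and the set of these nodes is such a
-- Z; hence requiring, for all of Z, that the label chosen by U agree with the
-- output row says exactly that the output is the string produced by the play.

open import Defs
open import Data.Bool using (Bool; true; false; _∧_)
open import Data.Bool.Properties using (⇔→≡; ¬-not)
open import Data.Empty using (⊥-elim)
open import Data.Fin using (Fin; zero; suc; _≟_)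
open import Data.Nat using (ℕ; zero; suc; _<_)
open import Data.Nat.Properties using (<-irrefl; ≮⇒≥; ≤-antisym; n<1+n)
open import Data.Product using (Σ; _×_; _,_; proj₁; proj₂; map₂)
open import Data.Sum using (_⊎_; inj₁; inj₂)
open import Function using (id; _∘_)
open import Function.Bundles using (_⇔_; mk⇔; Equivalence)
open import Relation.Nullary using (¬_; does; yes; no)
open import Relation.Nullary.Decidable using (dec-true)
open import Relation.Binary.PropositionalEquality using (_≡_; refl; sym; trans; cong)

open Equivalence using (to; from)

≮∧≯⇒≡ : ∀ {i j} → ¬ i < j × ¬ j < i → i ≡ j
≮∧≯⇒≡ (i≮j , j≮i) = ≤-antisym (≮⇒≥ j≮i) (≮⇒≥ i≮j)

≮∧≯-refl : ∀ i → ¬ i < i × ¬ i < i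
≮∧≯-refl i = <-irrefl refl , <-irrefl refl

≡-from-⇔ : ∀ {a b : Bool} → (a ≡ true → b ≡ true) × (b ≡ true → a ≡ true) → a ≡ b
≡-from-⇔ (f , g) = ⇔→≡ (mk⇔ f g)

≡-to-⇔ : ∀ {a b : Bool} → a ≡ b → (a ≡ true → b ≡ true) × (b ≡ true → a ≡ true)
≡-to-⇔ refl = id , id

module _ {n : ℕ} where

  sameLevel : ∀ {k m} → Fin k → Fin k → Formula n k m
  sameLevel x y = And (Not (Prec x y)) (Not (Prec y x))

  -- V₁ nodes are exactly those with a 0-edge into their own level.
  isV₁ : ∀ {k m} → Fin k → Formula n k m
  isV₁ x = Ex₁ (And (E false (suc x) zero) (sameLevel (suc x) zero))

  edgeBy : ∀ {k m} → Fin m → Fin k → Fin k → Fin k → Formula n k m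
  edgeBy S c a b = Or (And (Mem c S) (E true a b)) (And (Not (Mem c S)) (E false a b))

  iff : ∀ {k m} → Formula n k m → Formula n k m → Formula n k m
  iff φ ψ = And (Imp φ ψ) (Imp ψ φ)

  subsetOf : ∀ {k m} → Fin m → Formula n (suc k) m → Formula n k m
  subsetOf S φ = All₁ (Imp (Mem zero S) φ)

setX setY setU : Fin 3
setX = zero
setY = suc zero
setU = suc (suc zero)

setZ : Fin 4
setZ = zero

-- The variables of a round x → w → y, with t the node of R_{q_init} on the
-- level of x; alignedRounds binds them in the order x, w, y, t.
nodeX nodeW nodeY nodeT : Fin 4
nodeX = suc (suc (suc zero))
nodeW = suc (suc zero)
nodeY = suc zero
nodeT = zero

module _ {n : ℕ} where

  alignedRounds : Fin n → Formula n 4 4 → Formula n 0 4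
  alignedRounds q₀ φ =
    All₁ (All₁ (All₁ (All₁
      (Imp (Mem nodeX setZ) (Imp (R₁ q₀ nodeT) (Imp (sameLevel nodeT nodeX) φ))))))

  ∃play : Fin n → Formula n 4 4 → Formula n 0 3
  ∃play q₀ φ = Ex₂ (And (All₁ (Imp (Init zero) (Mem zero setZ))) (alignedRounds q₀ φ))

  roundᴵ roundᴵᴵ : Formula n 4 4
  roundᴵ =
    Imp (edgeBy (suc setU) nodeX nodeX nodeW)
    (Imp (edgeBy (suc setY) nodeT nodeW nodeY)
      (And (Mem nodeY setZ) (iff (Mem nodeX (suc setU)) (Mem nodeT (suc setX)))))
  roundᴵᴵ =
    Imp (edgeBy (suc setX) nodeT nodeX nodeW)
    (Imp (edgeBy (suc setU) nodeW nodeW nodeY)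
      (And (Mem nodeY setZ) (iff (Mem nodeW (suc setU)) (Mem nodeT (suc setY)))))

ψᴵ ψᴵᴵ : (A : Automaton) → Formula (nQ A) 0 3
ψᴵ A =
  And (subsetOf setU (isV₁ zero))
  (And (subsetOf setX (R₁ (qinit A) zero))
  (And (subsetOf setY (R₁ (qinit A) zero))
    (∃play (qinit A) roundᴵ)))
ψᴵᴵ A =
  And (subsetOf setU (Not (isV₁ zero)))
  (And (subsetOf setX (R₁ (qinit A) zero))
  (And (subsetOf setY (R₁ (qinit A) zero))
    (∃play (qinit A) roundᴵᴵ)))

module _ (A : Automaton) (P : SubsetN) where

  private
    n = nQ A
    q₀ = qinit A

  -- Satisfaction of edgeBy S c a b unfolds to Labelled (σ S (ρ c)) (ρ a) (ρ b).
  Labelled : Bool → V n → V n → Set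
  Labelled b u v = (b ≡ true × Edge A P true u v) ⊎ (¬ b ≡ true × Edge A P false u v)

  labelled : ∀ {u v} b → Edge A P b u v → Labelled b u v
  labelled true e = inj₁ (refl , e)
  labelled false e = inj₂ ((λ ()) , e)

  unlabelled : ∀ {b u v} → Labelled b u v → Edge A P b u v
  unlabelled {true} (inj₁ (_ , e)) = e
  unlabelled {false} (inj₁ (() , _))
  unlabelled {true} (inj₂ (b≢true , _)) = ⊥-elim (b≢true refl)
  unlabelled {false} (inj₂ (_ , e)) = e

  move₁ : ∀ a {q i} → Labelled a (inj₁ (q , i)) (inj₂ (q , a , i))
  move₁ a {q} {i} = labelled {inj₁ (q , i)} {inj₂ (q , a , i)} a (refl , refl , refl)

  move₂ : ∀ b {q a i} → Labelled b (inj₂ (q , a , i)) (inj₁ (δ A q (a , b , P i) , suc i))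
  move₂ b {q} {a} {i} = labelled {inj₂ (q , a , i)} {inj₁ _} b (refl , refl)

  edge-from-V₁ : ∀ {b q i w} → Edge A P b (inj₁ (q , i)) w → w ≡ inj₂ (q , b , i)
  edge-from-V₁ {w = inj₂ _} (refl , refl , refl) = refl

  edge-from-V₂ : ∀ {b q a i y} → Edge A P b (inj₂ (q , a , i)) y →
                 y ≡ inj₁ (δ A q (a , b , P i) , suc i)
  edge-from-V₂ {y = inj₁ _} (refl , refl) = refl

  round : ∀ {a b q i w y} → Labelled a (inj₁ (q , i)) w → Labelled b w y →
          w ≡ inj₂ (q , a , i) × y ≡ inj₁ (δ A q (a , b , P i) , suc i)
  round e₁ e₂ with refl ← edge-from-V₁ (unlabelled e₁) = refl , edge-from-V₂ (unlabelled e₂)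

  sat-isV₁ : ∀ {m} (σ : Fin m → Subset n) v →
             Sat A P (isV₁ zero) (extend v noVars) σ ⇔ Σ (V₁ n) λ w → v ≡ inj₁ w
  sat-isV₁ σ v = mk⇔ (onlyV₁ v)
    (λ { ((q , i) , refl) → inj₂ (q , false , i) , (refl , refl , refl) , ≮∧≯-refl i })
    where
    onlyV₁ : ∀ v → Sat A P (isV₁ zero) (extend v noVars) σ → Σ (V₁ n) λ w → v ≡ inj₁ w
    onlyV₁ (inj₁ w) _ = w , refl
    onlyV₁ (inj₂ (q , a , i)) (y , e , i≮y , _) with refl ← edge-from-V₂ e = ⊥-elim (i≮y (n<1+n i))

  sat-⊆V₁ : ∀ {m} (σ : Fin m → Subset n) S →
            Sat A P (subsetOf S (isV₁ zero)) noVars σ ⇔ σ S ⊆V₁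
  sat-⊆V₁ σ S = mk⇔ (λ h v v∈S → to (sat-isV₁ σ v) (h v v∈S))
                    (λ h v v∈S → from (sat-isV₁ σ v) (h v v∈S))

  sat-⊆V₂ : ∀ {m} (σ : Fin m → Subset n) S →
            Sat A P (subsetOf S (Not (isV₁ zero))) noVars σ ⇔ σ S ⊆V₂
  sat-⊆V₂ σ S = mk⇔ (λ h v v∈S → notV₁ v (h v v∈S))
                    (λ h v v∈S v∈V₁ → disjoint (to (sat-isV₁ σ v) v∈V₁) (h v v∈S))
    where
    notV₁ : ∀ v → ¬ Sat A P (isV₁ zero) (extend v noVars) σ → Σ (V₂ n) λ w → v ≡ inj₂ w
    notV₁ (inj₁ w) v∉V₁ = ⊥-elim (v∉V₁ (from (sat-isV₁ σ (inj₁ w)) (w , refl)))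
    notV₁ (inj₂ w) _ = w , refl

    disjoint : ∀ {v : V n} → Σ (V₁ n) (λ w → v ≡ inj₁ w) → ¬ Σ (V₂ n) (λ w → v ≡ inj₂ w)
    disjoint (_ , refl) (_ , ())

  playNodes : (ℕ → Fin n) → Subset n
  playNodes s (inj₁ (q , i)) = does (q ≟ s i)
  playNodes s (inj₂ _) = false

  playNodes-spine : ∀ s i → playNodes s (inj₁ (s i , i)) ≡ true
  playNodes-spine s i = dec-true (s i ≟ s i) refl

  data Aligned (s : ℕ → Fin n) : V n → V n → Set where
    aligned : ∀ i → Aligned s (inj₁ (s i , i)) (inj₁ (q₀ , i))

  aligned-view : ∀ s x {t} → playNodes s x ≡ true → InR₁ q₀ t → level t ≡ level x → Aligned s x t
  aligned-view s (inj₁ (q , i)) {inj₁ (_ , _)} x∈ refl refl with q ≟ s i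
  ... | yes refl = aligned i

  sat-∃play : (σ : Fin 3 → Subset n) (s : ℕ → Fin n) → s zero ≡ q₀ →
    (φ : Formula n 4 4) (Out : ℕ → Set) →
    (∀ Z → Sat A P (alignedRounds q₀ φ) noVars (extend Z σ) →
      ∀ i → Z (inj₁ (s i , i)) ≡ true → Z (inj₁ (s (suc i) , suc i)) ≡ true × Out i) →
    ((∀ i → Out i) → Sat A P (alignedRounds q₀ φ) noVars (extend (playNodes s) σ)) →
    Sat A P (∃play q₀ φ) noVars σ ⇔ (∀ i → Out i)
  sat-∃play σ s s₀ φ Out sound complete =
    mk⇔ along-play (λ out → playNodes s , initial , complete out)
    where
    along-play : Sat A P (∃play q₀ φ) noVars σ → ∀ i → Out i
    along-play (Z , Z∋init , rounds) i = proj₂ (sound Z rounds i (play⊆Z i))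
      where
      play⊆Z : ∀ i → Z (inj₁ (s i , i)) ≡ true
      play⊆Z zero = Z∋init _ (cong (λ q → inj₁ (q , zero)) s₀)
      play⊆Z (suc i) = proj₁ (sound Z rounds i (play⊆Z i))

    initial : ∀ v → v ≡ inj₁ (q₀ , zero) → playNodes s v ≡ true
    initial _ refl = dec-true (q₀ ≟ s zero) (sym s₀)

  ≐rep⇔ : ∀ {X : Subset n} {f : Str} → InitRow A X → X ≐ rep A f ⇔ (∀ i → unrep A X i ≡ f i)
  ≐rep⇔ {X} {f} X⊆row =
    mk⇔ (λ X≐ i → trans (X≐ (inj₁ (q₀ , i))) (cong (_∧ f i) (dec-true (q₀ ≟ q₀) refl))) pointwise
    where
    outside : ∀ v → ¬ InR₁ q₀ v → X v ≡ false
    outside v v∉row = ¬-not (λ v∈X → v∉row (X⊆row v v∈X))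

    pointwise : (∀ i → unrep A X i ≡ f i) → X ≐ rep A f
    pointwise X≗f (inj₁ (q , i)) with q ≟ q₀
    ... | yes refl = X≗f i
    ... | no q≢q₀ = outside (inj₁ (q , i)) q≢q₀
    pointwise X≗f (inj₂ w) = outside (inj₂ w) (λ ())

  play⇔ᴵ : (X Y U : Subset n) →
           Sat A P (∃play q₀ roundᴵ) noVars (assign3 X Y U) ⇔
             (∀ i → unrep A X i ≡ FI A P U (unrep A Y) i)
  play⇔ᴵ X Y U = sat-∃play (assign3 X Y U) s refl roundᴵ _ sound complete
    where
    s = stateI A P U (unrep A Y)

    sound : ∀ Z → Sat A P (alignedRounds q₀ roundᴵ) noVars (extend Z (assign3 X Y U)) →
            ∀ i → Z (inj₁ (s i , i)) ≡ true →
            Z (inj₁ (s (suc i) , suc i)) ≡ true × unrep A X i ≡ FI A P U (unrep A Y) i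
    sound Z rounds i Zx =
      map₂ (sym ∘ ≡-from-⇔)
        (rounds (inj₁ (s i , i)) (inj₂ (s i , FI A P U (unrep A Y) i , i))
                (inj₁ (s (suc i) , suc i)) (inj₁ (q₀ , i))
                Zx refl (≮∧≯-refl i) (move₁ _) (move₂ _))

    complete : (∀ i → unrep A X i ≡ FI A P U (unrep A Y) i) →
               Sat A P (alignedRounds q₀ roundᴵ) noVars (extend (playNodes s) (assign3 X Y U))
    complete out x w y t x∈ t∈row lvl e₁ e₂ with aligned-view s x x∈ t∈row (≮∧≯⇒≡ lvl)
    ... | aligned i with refl , refl ← round e₁ e₂ = playNodes-spine s (suc i) , ≡-to-⇔ (sym (out i))

  play⇔ᴵᴵ : (X Y U : Subset n) →
            Sat A P (∃play q₀ roundᴵᴵ) noVars (assign3 X Y U) ⇔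
              (∀ i → unrep A Y i ≡ FII A P U (unrep A X) i)
  play⇔ᴵᴵ X Y U = sat-∃play (assign3 X Y U) s refl roundᴵᴵ _ sound complete
    where
    s = stateII A P U (unrep A X)

    sound : ∀ Z → Sat A P (alignedRounds q₀ roundᴵᴵ) noVars (extend Z (assign3 X Y U)) →
            ∀ i → Z (inj₁ (s i , i)) ≡ true →
            Z (inj₁ (s (suc i) , suc i)) ≡ true × unrep A Y i ≡ FII A P U (unrep A X) i
    sound Z rounds i Zx =
      map₂ (sym ∘ ≡-from-⇔)
        (rounds (inj₁ (s i , i)) (inj₂ (s i , unrep A X i , i))
                (inj₁ (s (suc i) , suc i)) (inj₁ (q₀ , i))
                Zx refl (≮∧≯-refl i) (move₁ _) (move₂ _))

    complete : (∀ i → unrep A Y i ≡ FII A P U (unrep A X) i) →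
               Sat A P (alignedRounds q₀ roundᴵᴵ) noVars (extend (playNodes s) (assign3 X Y U))
    complete out x w y t x∈ t∈row lvl e₁ e₂ with aligned-view s x x∈ t∈row (≮∧≯⇒≡ lvl)
    ... | aligned i with refl , refl ← round e₁ e₂ = playNodes-spine s (suc i) , ≡-to-⇔ (sym (out i))

  ψᴵ-correct : (X Y U : Subset n) →
    Models A P (ψᴵ A) X Y U ⇔
      (U ⊆V₁ × InitRow A X × InitRow A Y × X ≐ rep A (FI A P U (unrep A Y)))
  ψᴵ-correct X Y U = mk⇔
    (λ (U⊆V₁ , X⊆row , Y⊆row , play) →
      to (sat-⊆V₁ σ setU) U⊆V₁ , X⊆row , Y⊆row , from (≐rep⇔ X⊆row) (to (play⇔ᴵ X Y U) play))
    (λ (U⊆V₁ , X⊆row , Y⊆row , X≐) →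
      from (sat-⊆V₁ σ setU) U⊆V₁ , X⊆row , Y⊆row , from (play⇔ᴵ X Y U) (to (≐rep⇔ X⊆row) X≐))
    where σ = assign3 X Y U

  ψᴵᴵ-correct : (X Y U : Subset n) →
    Models A P (ψᴵᴵ A) X Y U ⇔
      (U ⊆V₂ × InitRow A X × InitRow A Y × Y ≐ rep A (FII A P U (unrep A X)))
  ψᴵᴵ-correct X Y U = mk⇔
    (λ (U⊆V₂ , X⊆row , Y⊆row , play) →
      to (sat-⊆V₂ σ setU) U⊆V₂ , X⊆row , Y⊆row , from (≐rep⇔ Y⊆row) (to (play⇔ᴵᴵ X Y U) play))
    (λ (U⊆V₂ , X⊆row , Y⊆row , Y≐) →
      from (sat-⊆V₂ σ setU) U⊆V₂ , X⊆row , Y⊆row , from (play⇔ᴵᴵ X Y U) (to (≐rep⇔ Y⊆row) Y≐))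
    where σ = assign3 X Y U

lemma6p5 : Σ ((A : Automaton) → Formula (nQ A) 0 3) λ ψI →
           Σ ((A : Automaton) → Formula (nQ A) 0 3) λ ψII →
           (A : Automaton) (P : SubsetN) (X Y U : Subset (nQ A)) →
             (Models A P (ψI A) X Y U ⇔
               (U ⊆V₁ × InitRow A X × InitRow A Y
                 × X ≐ rep A (FI A P U (unrep A Y))))
           × (Models A P (ψII A) X Y U ⇔
               (U ⊆V₂ × InitRow A X × InitRow A Y
                 × Y ≐ rep A (FII A P U (unrep A X))))
lemma6p5 = ψᴵ , ψᴵᴵ , λ A P X Y U → ψᴵ-correct A P X Y U , ψᴵᴵ-correct A P X Y U
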